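{- Let $n\ge1$ and $a\in[2n]$. For all $\ell\in[n]$, $$\big|\{P\in\mathcal{D}_n: u^{(a)}_{\max}(P)=\ell\}\big|=\big|\{P\in\mathcal{D}_n: h(P)=\ell\}\big|.$$
   Context: A Dyck path of size $n$ is a word $P_1\cdots P_{2n}$ in $\mathtt{u},\mathtt{d}$ with $n$ of each letter whose every prefix has at least as many $\mathtt{u}$'s as $\mathtt{d}$'s; $\mathcal{D}_n$ is their set. The tunneling $\tau_P\in S_{2n}$ is the fixed-point-free involution pairing each up-step position with the position of its matching down-step. The height $h_k(P)$ is the number of $\mathtt{u}$'s minus the number of $\mathtt{d}$'s among $P_1,\dots,P_k$, and $h(P)=\max_{k\in[2n]}h_k(P)$ is the height of the highest peak. For $S\subseteq[2n]$, a step $i\in S$ is unpaired in $S$ if $\tau_P(i)\notin S$. $u_{a,k}(P)$ is the number of unpaired steps in $\{a,a+1,\dots,a+k-1\}$ (indices modulo $2n$, in $[2n]$), and $u^{(a)}_{\max}(P)=\max_{k\in[2n]}u_{a,k}(P)$. -}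

module Defs where

open import Data.Nat using (ℕ; zero; suc; _+_; _*_; _∸_; _⊔_; _%_; _≡ᵇ_; _≤ᵇ_; NonZero)
open import Data.Bool using (Bool; true; false; not; _∧_; if_then_else_)
open import Data.List using (List; []; _∷_; map; foldr; filter; length; take; upTo; applyUpTo; concatMap)
open import Data.Bool.ListAction using (any; all)
open import Relation.Nullary.Decidable using (does)
open import Data.Bool.Properties using (T?)
open import Data.Bool using (T)

data Step : Set where
  u d : Step

isU : Step → Bool
isU u = true
isU d = false

isD : Step → Bool
isD u = false
isD d = true

#u : List Step → ℕ
#u []       = 0
#u (s ∷ w)  = (if isU s then 1 else 0) + #u w

#d : List Step → ℕ
#d []       = 0
#d (s ∷ w)  = (if isD s then 1 else 0) + #d w

words : ℕ → List (List Step)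
words zero    = [] ∷ []
words (suc m) = concatMap (λ w → (u ∷ w) ∷ (d ∷ w) ∷ []) (words m)

range1 : ℕ → List ℕ
range1 m = applyUpTo suc m

isDyck : ℕ → List Step → Bool
isDyck n P = (#u P ≡ᵇ n) ∧ (#d P ≡ᵇ n)
           ∧ all (λ k → #d (take k P) ≤ᵇ #u (take k P)) (upTo (suc (length P)))

Dyck : ℕ → List (List Step)
Dyck n = filter (λ P → T? (isDyck n P)) (words (n + n))

-- height h_k(P) = #u − #d among P_1..P_k (nonnegative on Dyck paths)
hk : List Step → ℕ → ℕ
hk P k = #u (take k P) ∸ #d (take k P)

maxOver : List ℕ → ℕ
maxOver = foldr _⊔_ 0

height : List Step → ℕ
height P = maxOver (map (hk P) (range1 (length P)))

-- the step P_i (1-based); default u out of range (never used)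
stepAt : List Step → ℕ → Step
stepAt []      _             = u
stepAt (s ∷ w) zero          = u
stepAt (s ∷ w) (suc zero)    = s
stepAt (s ∷ w) (suc (suc i)) = stepAt w (suc i)

firstSat : (ℕ → Bool) → List ℕ → ℕ
firstSat p []       = 0
firstSat p (j ∷ js) = if p j then j else firstSat p js

ascFrom : ℕ → ℕ → List ℕ
ascFrom i m = applyUpTo (λ t → suc (i + t)) (m ∸ i)

descFrom : ℕ → List ℕ
descFrom zero    = []
descFrom (suc i) = go i
  where
  go : ℕ → List ℕ
  go zero    = []
  go (suc j) = suc j ∷ go j

-- the tunneling τ_P (positions 1-based):
--  for an up-step i, τ(i) is the first j > i with h_j = h_{i-1};
--  for a down-step i, τ(i) is the last j < i with h_{j-1} = h_i.
tunnel : List Step → ℕ → ℕ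
tunnel P i with stepAt P i
... | u = firstSat (λ j → hk P j ≡ᵇ hk P (i ∸ 1)) (ascFrom i (length P))
... | d = firstSat (λ j → hk P (j ∸ 1) ≡ᵇ hk P i) (descFrom i)

_∈ᵇ_ : ℕ → List ℕ → Bool
j ∈ᵇ S = any (λ x → x ≡ᵇ j) S

-- the cyclic window {a, a+1, ..., a+k-1} (mod 2n, in [2n]), with 2n = m
window : (m : ℕ) → .{{NonZero m}} → ℕ → ℕ → List ℕ
window m a k = applyUpTo (λ t → suc (((a ∸ 1) + t) % m)) k

unpairedIn : List Step → List ℕ → ℕ
unpairedIn P S = length (filter (λ i → T? (not (tunnel P i ∈ᵇ S))) S)

uak : (n : ℕ) → .{{NonZero n}} → List Step → ℕ → ℕ → ℕ
uak (suc n) P a k = unpairedIn P (window (suc n + suc n) a k)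

umax : (n : ℕ) → .{{NonZero n}} → ℕ → List Step → ℕ
umax n a P = maxOver (map (uak n P a) (range1 (n + n)))

countDyck : ℕ → (List Step → ℕ) → ℕ → ℕ
countDyck n f ℓ = length (filter (λ P → T? (f P ≡ᵇ ℓ)) (Dyck n))

-- Every step of a Dyck path is matched by the tunnelling, compatibly with the first-return
-- decomposition P = u A d B.  Two consequences give the theorem.  In a prefix window [1..k]
-- the unpaired steps are the up steps whose partner lies beyond k, so u_{1,k}(P) = h_k(P) and
-- u^{(1)}_max = h.  And the bijection u A d B ↦ A u B d of 𝒟_n conjugates the tunnelling by
-- the cyclic shift i ↦ i - 1, so it carries the windows starting at a + 1 to those starting
-- at a; hence u^{(a+1)}_max and u^{(a)}_max are equidistributed, and induction on a reduces
-- everything to a = 1.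
module Submission where

open import Defs

open import Data.Nat using (ℕ; zero; suc; _+_; _∸_; _%_; _≡ᵇ_; _≤ᵇ_; _≤_; _<_; _≰_; z≤n; s≤s; NonZero)
open import Data.Nat.Properties
open import Data.Nat.DivMod using (m<n⇒m%n≡m; m%n<n; %-pred-≡0; m<[1+n%d]⇒m≤[n%d]; [1+m%d]≤1+n⇒[m%d]≤n)
open import Data.Bool using (Bool; true; false; not; _∨_; if_then_else_; T)
open import Data.Bool.Properties using (T?; T-≡; T-∧)
open import Data.Bool.ListAction using (any)
open import Data.Empty using (⊥-elim)
open import Data.Product using (∃; _×_; _,_; proj₁; proj₂; map₁; map₂) renaming (map to ×-map)
open import Data.List using (List; []; _∷_; _++_; map; filter; length; take; reverse; applyUpTo)
open import Data.List.Properties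
  using ( length-++; length-++-≤ˡ; length-map; length-reverse; ++-assoc; ++-identityʳ; take-all
        ; map-++; map-∘; map-id; map-cong; map-cong-local; map-applyUpTo
        ; reverse-++; reverse-map; unfold-reverse; reverse-involutive )
open import Data.List.Relation.Unary.All using (All; []; _∷_; universal; tabulate)
  renaming (lookup to All-lookup; map to All-map)
open import Data.List.Relation.Unary.All.Properties using (applyUpTo⁺₁; applyUpTo⁻; all⁺; all⁻)
  renaming (map⁺ to All-map⁺)
open import Data.List.Relation.Unary.Any using (here; there) renaming (map to Any-map)
open import Data.List.Relation.Unary.AllPairs using ([]; _∷_) renaming (map to AllPairs-map)
import Data.List.Relation.Unary.AllPairs.Properties as AllPairs
open import Data.List.Relation.Unary.Unique.Propositional using (Unique)
import Data.List.Relation.Unary.Unique.Propositional.Properties as Unique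
open import Data.List.Membership.Propositional using (_∈_; find)
open import Data.List.Membership.Propositional.Properties
  using (∈-map⁺; ∈-map⁻; ∈-concatMap⁺; ∈-concatMap⁻; ∈-filter⁺; ∈-filter⁻)
open import Data.List.Membership.Propositional.Properties.WithK using (unique∧set⇒bag)
open import Data.List.Relation.Binary.Disjoint.Propositional using (Disjoint)
open import Data.List.Relation.Binary.BagAndSetEquality using (∼bag⇒↭)
open import Data.List.Relation.Binary.Permutation.Propositional using (_↭_)
open import Data.List.Relation.Binary.Permutation.Propositional.Properties using (filter-↭; ↭-length)
open import Function.Bundles using (Equivalence; mk⇔)
open import Relation.Binary.Definitions using (tri<; tri≈; tri>)
open import Relation.Binary.PropositionalEquality
open import Relation.Nullary using (yes; no)

-- Counting and searching in lists

-- Both countDyck and unpairedIn unfold to instances of count.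
count : {A : Set} → (A → Bool) → List A → ℕ
count p xs = length (filter (λ x → T? (p x)) xs)

module _ {A : Set} where

  count-cong : ∀ {p q : A → Bool} xs → All (λ x → p x ≡ q x) xs → count p xs ≡ count q xs
  count-cong [] [] = refl
  count-cong {p} {q} (x ∷ xs) (e ∷ es) with p x | q x | e
  ... | true  | true  | refl = cong suc (count-cong xs es)
  ... | false | false | refl = count-cong xs es

  count-map : ∀ {B : Set} (p : B → Bool) (f : A → B) xs → count p (map f xs) ≡ count (λ x → p (f x)) xs
  count-map p f [] = refl
  count-map p f (x ∷ xs) with p (f x)
  ... | true  = cong suc (count-map p f xs)
  ... | false = count-map p f xs

  count-++ : ∀ (p : A → Bool) xs ys → count p (xs ++ ys) ≡ count p xs + count p ys
  count-++ p [] ys = refl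
  count-++ p (x ∷ xs) ys with p x
  ... | true  = cong suc (count-++ p xs ys)
  ... | false = count-++ p xs ys

  count-none : ∀ {p : A → Bool} xs → All (λ x → p x ≡ false) xs → count p xs ≡ 0
  count-none [] [] = refl
  count-none {p} (x ∷ xs) (e ∷ es) with p x | e
  ... | false | refl = count-none xs es

  count-here : ∀ {p : A → Bool} x xs → p x ≡ true → count p (x ∷ xs) ≡ suc (count p xs)
  count-here {p} x xs e with p x | e
  ... | true | refl = refl

  count-↭ : ∀ (p : A → Bool) {xs ys} → xs ↭ ys → count p xs ≡ count p ys
  count-↭ p xs↭ys = ↭-length (filter-↭ (λ x → T? (p x)) xs↭ys)

  Unique-map⁺-local : ∀ {f : A → A} {xs} → (∀ {x y} → x ∈ xs → y ∈ xs → f x ≡ f y → x ≡ y) →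
    Unique xs → Unique (map f xs)
  Unique-map⁺-local {xs = []}     _   []           = []
  Unique-map⁺-local {xs = x ∷ xs} inj (x∉xs ∷ uxs) =
    All-map⁺ (tabulate (λ y∈xs fx≡fy → All-lookup x∉xs y∈xs (inj (here refl) (there y∈xs) fx≡fy)))
    ∷ Unique-map⁺-local (λ x∈ y∈ → inj (there x∈) (there y∈)) uxs

  count-bijection : ∀ (p : A → Bool) (f g : A → A) {xs} → Unique xs →
    (∀ {x} → x ∈ xs → f x ∈ xs) → (∀ {x} → x ∈ xs → g x ∈ xs) →
    (∀ {x} → x ∈ xs → g (f x) ≡ x) → (∀ {x} → x ∈ xs → f (g x) ≡ x) →
    count (λ x → p (f x)) xs ≡ count p xs
  count-bijection p f g {xs} uxs f∈ g∈ g∘f f∘g =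
    trans (sym (count-map p f xs))
          (count-↭ p (∼bag⇒↭ (unique∧set⇒bag (Unique-map⁺-local injective uxs) uxs (mk⇔ onto into))))
    where
    injective : ∀ {x y} → x ∈ xs → y ∈ xs → f x ≡ f y → x ≡ y
    injective x∈ y∈ fx≡fy = trans (sym (g∘f x∈)) (trans (cong g fx≡fy) (g∘f y∈))
    onto : ∀ {y} → y ∈ map f xs → y ∈ xs
    onto y∈ with ∈-map⁻ f y∈
    ... | x , x∈ , refl = f∈ x∈
    into : ∀ {y} → y ∈ xs → y ∈ map f xs
    into y∈ = subst (_∈ map f xs) (f∘g y∈) (∈-map⁺ f (g∈ y∈))

any-map : ∀ {A B : Set} (p : B → Bool) (f : A → B) xs → any p (map f xs) ≡ any (λ x → p (f x)) xs
any-map p f [] = refl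
any-map p f (x ∷ xs) = cong (p (f x) ∨_) (any-map p f xs)

any-cong : ∀ {A : Set} {p q : A → Bool} xs → All (λ x → p x ≡ q x) xs → any p xs ≡ any q xs
any-cong []       []       = refl
any-cong (x ∷ xs) (e ∷ es) = cong₂ _∨_ e (any-cong xs es)

∈ᵇ-map : ∀ (f : ℕ → ℕ) x S → All (λ y → (f y ≡ᵇ f x) ≡ (y ≡ᵇ x)) S → (f x ∈ᵇ map f S) ≡ (x ∈ᵇ S)
∈ᵇ-map f x S eqs = trans (any-map (λ y → y ≡ᵇ f x) f S) (any-cong S eqs)

≡ᵇ-refl : ∀ n → (n ≡ᵇ n) ≡ true
≡ᵇ-refl n = Equivalence.to T-≡ (≡⇒≡ᵇ n n refl)

≢⇒≡ᵇ-false : ∀ {m n} → m ≢ n → (m ≡ᵇ n) ≡ false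
≢⇒≡ᵇ-false {m} {n} m≢n with m ≡ᵇ n in eq
... | true  = ⊥-elim (m≢n (≡ᵇ⇒≡ m n (Equivalence.from T-≡ eq)))
... | false = refl

data IsFirst (p : ℕ → Bool) : List ℕ → ℕ → Set where
  here  : ∀ {x xs} → p x ≡ true → IsFirst p (x ∷ xs) x
  there : ∀ {x xs j} → p x ≡ false → IsFirst p xs j → IsFirst p (x ∷ xs) j

module _ {p : ℕ → Bool} where

  firstSat-IsFirst : ∀ {xs j} → IsFirst p xs j → firstSat p xs ≡ j
  firstSat-IsFirst (here {x} {xs} e)    = cong (if_then x else firstSat p xs) e
  firstSat-IsFirst (there {x} {xs} e hit) =
    trans (cong (if_then x else firstSat p xs) e) (firstSat-IsFirst hit)

  IsFirst-++ʳ : ∀ {xs j} ys → IsFirst p xs j → IsFirst p (xs ++ ys) j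
  IsFirst-++ʳ ys (here e)      = here e
  IsFirst-++ʳ ys (there e hit) = there e (IsFirst-++ʳ ys hit)

  IsFirst-++ˡ : ∀ {ys j} xs → All (λ x → p x ≡ false) xs → IsFirst p ys j → IsFirst p (xs ++ ys) j
  IsFirst-++ˡ []       []       hit = hit
  IsFirst-++ˡ (x ∷ xs) (e ∷ es) hit = there e (IsFirst-++ˡ xs es hit)

  IsFirst-all : ∀ {Q : ℕ → Set} {xs j} → IsFirst p xs j → All Q xs → Q j
  IsFirst-all (here e)      (q ∷ _)  = q
  IsFirst-all (there e hit) (_ ∷ qs) = IsFirst-all hit qs

  IsFirst-cong : ∀ {q : ℕ → Bool} {xs j} → All (λ x → q x ≡ p x) xs → IsFirst p xs j → IsFirst q xs j
  IsFirst-cong (e ∷ _)  (here e′)      = here (trans e e′)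
  IsFirst-cong (e ∷ es) (there e′ hit) = there (trans e e′) (IsFirst-cong es hit)

  IsFirst-map : ∀ {q : ℕ → Bool} (f : ℕ → ℕ) {xs j} →
    All (λ x → q (f x) ≡ p x) xs → IsFirst p xs j → IsFirst q (map f xs) (f j)
  IsFirst-map f (e ∷ _)  (here e′)      = here (trans e e′)
  IsFirst-map f (e ∷ es) (there e′ hit) = there (trans e e′) (IsFirst-map f es hit)

-- Index ranges

applyUpTo-+ : ∀ {A : Set} (f : ℕ → A) a b → applyUpTo f (a + b) ≡ applyUpTo f a ++ applyUpTo (λ t → f (a + t)) b
applyUpTo-+ f zero    b = refl
applyUpTo-+ f (suc a) b = cong (f 0 ∷_) (applyUpTo-+ (λ t → f (suc t)) a b)

applyUpTo-cong : ∀ {A : Set} {f g : ℕ → A} n → (∀ t → t < n → f t ≡ g t) → applyUpTo f n ≡ applyUpTo g n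
applyUpTo-cong zero    eq = refl
applyUpTo-cong (suc n) eq = cong₂ _∷_ (eq 0 (s≤s z≤n)) (applyUpTo-cong n (λ t t<n → eq (suc t) (s≤s t<n)))

ascFrom-split : ∀ i j k → i ≤ j → j ≤ k → ascFrom i k ≡ ascFrom i j ++ ascFrom j k
ascFrom-split i j k i≤j j≤k = begin
    applyUpTo (λ t → suc (i + t)) (k ∸ i)
  ≡⟨ cong (applyUpTo (λ t → suc (i + t))) k∸i ⟩
    applyUpTo (λ t → suc (i + t)) ((j ∸ i) + (k ∸ j))
  ≡⟨ applyUpTo-+ (λ t → suc (i + t)) (j ∸ i) (k ∸ j) ⟩
    ascFrom i j ++ applyUpTo (λ t → suc (i + ((j ∸ i) + t))) (k ∸ j)
  ≡⟨ cong (ascFrom i j ++_) (applyUpTo-cong (k ∸ j) (λ t _ → cong suc (i+[[j∸i]+t] t))) ⟩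
    ascFrom i j ++ ascFrom j k ∎
  where
  open ≡-Reasoning
  k∸i : k ∸ i ≡ (j ∸ i) + (k ∸ j)
  k∸i = trans (cong (_∸ i) (sym (m+[n∸m]≡n j≤k))) (+-∸-comm (k ∸ j) i≤j)
  i+[[j∸i]+t] : ∀ t → i + ((j ∸ i) + t) ≡ j + t
  i+[[j∸i]+t] t = trans (sym (+-assoc i (j ∸ i) t)) (cong (_+ t) (m+[n∸m]≡n i≤j))

ascFrom-+ : ∀ c i k → ascFrom (c + i) (c + k) ≡ map (c +_) (ascFrom i k)
ascFrom-+ c i k = begin
    applyUpTo (λ t → suc (c + i + t)) ((c + k) ∸ (c + i))
  ≡⟨ cong (applyUpTo (λ t → suc (c + i + t))) ([m+n]∸[m+o]≡n∸o c k i) ⟩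
    applyUpTo (λ t → suc (c + i + t)) (k ∸ i)
  ≡⟨ applyUpTo-cong (k ∸ i) (λ t _ → trans (cong suc (+-assoc c i t)) (sym (+-suc c (i + t)))) ⟩
    applyUpTo (λ t → c + suc (i + t)) (k ∸ i)
  ≡⟨ sym (map-applyUpTo (λ t → suc (i + t)) (c +_) (k ∸ i)) ⟩
    map (c +_) (ascFrom i k) ∎
  where open ≡-Reasoning

ascFrom-bounds : ∀ i k → All (λ j → i < j × j ≤ k) (ascFrom i k)
ascFrom-bounds i k = applyUpTo⁺₁ _ (k ∸ i) (λ {t} t<k∸i → s≤s (m≤m+n i t) , bound t t<k∸i)
  where
  bound : ∀ t → t < k ∸ i → suc (i + t) ≤ k
  bound t t<k∸i = subst (_≤ k) (cong suc (+-comm t i)) (m≤o∸n⇒m+n≤o (suc t) i≤k t<k∸i)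
    where
    i≤k : i ≤ k
    i≤k = <⇒≤ (m∸n≢0⇒n<m (λ k∸i≡0 → n≮0 (subst (t <_) k∸i≡0 t<k∸i)))

ascFrom-lift : ∀ i L → i ≤ L → ascFrom (suc i) (suc (suc L)) ≡ map suc (ascFrom i L) ++ suc (suc L) ∷ []
ascFrom-lift i L i≤L = begin
    ascFrom (suc i) (suc (suc L))
  ≡⟨ ascFrom-split (suc i) (suc L) (suc (suc L)) (s≤s i≤L) (n≤1+n _) ⟩
    ascFrom (suc i) (suc L) ++ ascFrom (suc L) (suc (suc L))
  ≡⟨ cong₂ _++_ (ascFrom-+ 1 i L) last ⟩
    map suc (ascFrom i L) ++ suc (suc L) ∷ [] ∎
  where
  open ≡-Reasoning
  last : ascFrom (suc L) (suc (suc L)) ≡ suc (suc L) ∷ []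
  last rewrite m+n∸n≡m 1 L | +-identityʳ L = refl

descFrom-bounds : ∀ i → All (λ j → 1 ≤ j × j < i) (descFrom i)
descFrom-bounds zero          = []
descFrom-bounds (suc zero)    = []
descFrom-bounds (suc (suc i)) =
  (s≤s z≤n , ≤-refl) ∷ All-map (map₁-≤ m≤n⇒m≤1+n) (descFrom-bounds (suc i))
  where
  map₁-≤ : ∀ {j} → (j < suc i → j < suc (suc i)) → 1 ≤ j × j < suc i → 1 ≤ j × j < suc (suc i)
  map₁-≤ f (p , q) = p , f q

descFrom-+ : ∀ c t → descFrom (c + suc t) ≡ map (c +_) (descFrom (suc t)) ++ descFrom (suc c)
descFrom-+ c zero    rewrite +-suc c 0 | +-identityʳ c = refl
descFrom-+ c (suc t) rewrite +-suc c (suc t) | +-suc c t =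
  cong (suc (c + t) ∷_) (trans (cong descFrom (sym (+-suc c t))) (descFrom-+ c t))

range1-+ : ∀ a b → range1 (a + b) ≡ range1 a ++ map (a +_) (range1 b)
range1-+ a b = trans (applyUpTo-+ suc a b) (cong (range1 a ++_) (begin
    applyUpTo (λ t → suc (a + t)) b ≡⟨ applyUpTo-cong b (λ t _ → sym (+-suc a t)) ⟩
    applyUpTo (λ t → a + suc t) b   ≡⟨ sym (map-applyUpTo suc (a +_) b) ⟩
    map (a +_) (range1 b)           ∎))
  where open ≡-Reasoning

range1-bounds : ∀ k → All (λ x → 1 ≤ x × x ≤ k) (range1 k)
range1-bounds k = applyUpTo⁺₁ suc k (λ t<k → s≤s z≤n , t<k)

∈ᵇ-range1 : ∀ {x k} → 1 ≤ x → x ≤ k → (x ∈ᵇ range1 k) ≡ true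
∈ᵇ-range1 {suc zero}    {suc k} _ _ = refl
∈ᵇ-range1 {suc (suc x)} {suc k} _ (s≤s x<k) =
  trans (cong (any (_≡ᵇ suc (suc x))) (range1-+ 1 k))
        (trans (any-map (_≡ᵇ suc (suc x)) suc (range1 k)) (∈ᵇ-range1 {suc x} (s≤s z≤n) x<k))

∉ᵇ-range1 : ∀ {x k} → k < x → (x ∈ᵇ range1 k) ≡ false
∉ᵇ-range1 {x}           {zero}  _ = refl
∉ᵇ-range1 {suc (suc x)} {suc k} (s≤s k<x) =
  trans (cong (any (_≡ᵇ suc (suc x))) (range1-+ 1 k))
        (trans (any-map (_≡ᵇ suc (suc x)) suc (range1 k)) (∉ᵇ-range1 k<x))

+-∈ᵇ-range1 : ∀ c {y} t → 1 ≤ y → ((c + y) ∈ᵇ range1 (c + t)) ≡ (y ∈ᵇ range1 t)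
+-∈ᵇ-range1 c {y} t 1≤y with y ≤? t
... | yes y≤t = trans (∈ᵇ-range1 (≤-trans 1≤y (m≤n+m y c)) (+-monoʳ-≤ c y≤t)) (sym (∈ᵇ-range1 1≤y y≤t))
... | no  y≰t = trans (∉ᵇ-range1 (+-monoʳ-< c (≰⇒> y≰t))) (sym (∉ᵇ-range1 (≰⇒> y≰t)))

data Within (L : ℕ) : ℕ → Set where
  inside : ∀ {s} → s ≤ L → Within L s
  beyond : ∀ t → Within L (L + suc t)

within : ∀ L s → Within L s
within L       zero    = inside z≤n
within zero    (suc s) = beyond s
within (suc L) (suc s) with within L s
... | inside s≤L = inside (s≤s s≤L)
... | beyond t   = beyond t

-- Dyck paths and heights

#u-++ : ∀ X Y → #u (X ++ Y) ≡ #u X + #u Y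
#u-++ []      Y = refl
#u-++ (s ∷ X) Y = trans (cong (_ +_) (#u-++ X Y)) (sym (+-assoc (if isU s then 1 else 0) (#u X) (#u Y)))

#d-++ : ∀ X Y → #d (X ++ Y) ≡ #d X + #d Y
#d-++ []      Y = refl
#d-++ (s ∷ X) Y = trans (cong (_ +_) (#d-++ X Y)) (sym (+-assoc (if isD s then 1 else 0) (#d X) (#d Y)))

take-++ˡ : ∀ {A : Set} (X Y : List A) k → k ≤ length X → take k (X ++ Y) ≡ take k X
take-++ˡ X       Y zero    _         = refl
take-++ˡ (x ∷ X) Y (suc k) (s≤s k≤L) = cong (x ∷_) (take-++ˡ X Y k k≤L)

take-++ʳ : ∀ {A : Set} (X Y : List A) t → take (length X + t) (X ++ Y) ≡ X ++ take t Y
take-++ʳ []      Y t = refl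
take-++ʳ (x ∷ X) Y t = cong (x ∷_) (take-++ʳ X Y t)

Balanced : List Step → Set
Balanced X = #u X ≡ #d X

NonNegative : List Step → Set
NonNegative X = ∀ k → #d (take k X) ≤ #u (take k X)

lift : List Step → List Step
lift X = u ∷ (X ++ d ∷ [])

length-lift : ∀ X → length (lift X) ≡ suc (suc (length X))
length-lift X = cong suc (trans (length-++ X) (+-comm (length X) 1))

lift-++ : ∀ X Y → lift X ++ Y ≡ u ∷ (X ++ d ∷ Y)
lift-++ X Y = cong (u ∷_) (++-assoc X (d ∷ []) Y)

#u-lift : ∀ X → #u (lift X) ≡ suc (#u X)
#u-lift X = cong suc (trans (#u-++ X (d ∷ [])) (+-identityʳ (#u X)))

#d-lift : ∀ X → #d (lift X) ≡ suc (#d X)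
#d-lift X = trans (#d-++ X (d ∷ [])) (+-comm (#d X) 1)

Balanced-++ : ∀ {X Y} → Balanced X → Balanced Y → Balanced (X ++ Y)
Balanced-++ {X} {Y} bX bY = begin
  #u (X ++ Y)   ≡⟨ #u-++ X Y ⟩
  #u X + #u Y   ≡⟨ cong₂ _+_ bX bY ⟩
  #d X + #d Y   ≡⟨ sym (#d-++ X Y) ⟩
  #d (X ++ Y)   ∎
  where open ≡-Reasoning

Balanced-lift : ∀ {X} → Balanced X → Balanced (lift X)
Balanced-lift {X} bX = trans (#u-lift X) (trans (cong suc bX) (sym (#d-lift X)))

NonNegative-++ : ∀ {X Y} → NonNegative X → Balanced X → NonNegative Y → NonNegative (X ++ Y)
NonNegative-++ {X} {Y} nX bX nY s with within (length X) s
... | inside s≤L rewrite take-++ˡ X Y s s≤L = nX s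
... | beyond t rewrite take-++ʳ X Y (suc t) | #u-++ X (take (suc t) Y) | #d-++ X (take (suc t) Y) | bX =
  +-monoʳ-≤ (#d X) (nY (suc t))

NonNegative-lift : ∀ {X} → NonNegative X → Balanced X → NonNegative (lift X)
NonNegative-lift nX bX zero = z≤n
NonNegative-lift {X} nX bX (suc s) with within (length X) s
... | inside s≤L rewrite take-++ˡ X (d ∷ []) s s≤L = m≤n⇒m≤1+n (nX s)
... | beyond zero    rewrite take-++ʳ X (d ∷ []) 1 = ≤-reflexive (sym (Balanced-lift {X} bX))
... | beyond (suc t) rewrite take-++ʳ X (d ∷ []) (suc (suc t)) = ≤-reflexive (sym (Balanced-lift {X} bX))

lift-overshoot : ∀ X t → suc (length X + suc (suc t)) ≰ length (lift X)
lift-overshoot X t i≤M =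
  m+1+n≰m (suc (length X)) (subst (_≤ suc (length X)) (+-suc (length X) (suc t))
                              (≤-pred (≤-trans i≤M (≤-reflexive (length-lift X)))))

length-++-cancelˡ : ∀ {A : Set} (X : List A) {Y} t → length X + suc t ≤ length (X ++ Y) → suc t ≤ length Y
length-++-cancelˡ X t bound = +-cancelˡ-≤ (length X) _ _ (≤-trans bound (≤-reflexive (length-++ X)))

data DyckPath : List Step → Set where
  []   : DyckPath []
  join : ∀ {X Y} → DyckPath X → DyckPath Y → DyckPath (lift X ++ Y)

DyckPath-balanced : ∀ {P} → DyckPath P → Balanced P
DyckPath-balanced []           = refl
DyckPath-balanced (join {X} {Y} dX dY) =
  Balanced-++ {lift X} {Y} (Balanced-lift {X} (DyckPath-balanced dX)) (DyckPath-balanced dY)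

DyckPath-nonNegative : ∀ {P} → DyckPath P → NonNegative P
DyckPath-nonNegative []           zero    = z≤n
DyckPath-nonNegative []           (suc s) = z≤n
DyckPath-nonNegative (join {X} {Y} dX dY) =
  NonNegative-++ {lift X} {Y} (NonNegative-lift {X} (DyckPath-nonNegative dX) (DyckPath-balanced dX))
    (Balanced-lift {X} (DyckPath-balanced dX)) (DyckPath-nonNegative dY)

DyckPath-++ : ∀ {X Y} → DyckPath X → DyckPath Y → DyckPath (X ++ Y)
DyckPath-++                  []           dZ = dZ
DyckPath-++ {Y = Z} (join {X} {Y} dX dY) dZ =
  subst DyckPath (sym (++-assoc (lift X) Y Z)) (join dX (DyckPath-++ dY dZ))

DyckPath-lift : ∀ {X} → DyckPath X → DyckPath (lift X)
DyckPath-lift {X} dX = subst DyckPath (++-identityʳ (lift X)) (join dX [])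

hk-++ˡ : ∀ X Y k → k ≤ length X → hk (X ++ Y) k ≡ hk X k
hk-++ˡ X Y k k≤L = cong (λ Z → #u Z ∸ #d Z) (take-++ˡ X Y k k≤L)

hk-++ʳ : ∀ X Y t → Balanced X → hk (X ++ Y) (length X + t) ≡ hk Y t
hk-++ʳ X Y t bX rewrite take-++ʳ X Y t | #u-++ X (take t Y) | #d-++ X (take t Y) | bX =
  [m+n]∸[m+o]≡n∸o (#d X) (#u (take t Y)) (#d (take t Y))

hk-lift : ∀ X t → NonNegative X → t ≤ length X → hk (lift X) (suc t) ≡ suc (hk X t)
hk-lift X t nX t≤L rewrite take-++ˡ X (d ∷ []) t t≤L = +-∸-assoc 1 (nX t)

hk-lift-end : ∀ X → Balanced X → hk (lift X) (suc (suc (length X))) ≡ 0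
hk-lift-end X bX = begin
  hk (lift X) (suc (suc (length X))) ≡⟨ cong (λ Z → #u Z ∸ #d Z) (take-all _ (lift X) (≤-reflexive (length-lift X))) ⟩
  #u (lift X) ∸ #d (lift X)          ≡⟨ cong (_∸ #d (lift X)) (Balanced-lift {X} bX) ⟩
  #d (lift X) ∸ #d (lift X)          ≡⟨ n∸n≡0 (#d (lift X)) ⟩
  0                                  ∎
  where open ≡-Reasoning

-- The tunnelling of a Dyck path

stepAt-++ˡ : ∀ X Y i → 1 ≤ i → i ≤ length X → stepAt (X ++ Y) i ≡ stepAt X i
stepAt-++ˡ (x ∷ X) Y (suc zero)    _ _         = refl
stepAt-++ˡ (x ∷ X) Y (suc (suc i)) _ (s≤s i<L) = stepAt-++ˡ X Y (suc i) (s≤s z≤n) i<L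

stepAt-++ʳ : ∀ X Y t → stepAt (X ++ Y) (length X + suc t) ≡ stepAt Y (suc t)
stepAt-++ʳ []      Y t = refl
stepAt-++ʳ (x ∷ X) Y t rewrite +-suc (length X) t | sym (+-suc (length X) t) = stepAt-++ʳ X Y t

stepAt-lift-end : ∀ X → stepAt (lift X) (suc (suc (length X))) ≡ d
stepAt-lift-end X = subst (λ i → stepAt (X ++ d ∷ []) i ≡ d) (+-comm (length X) 1) (stepAt-++ʳ X (d ∷ []) 0)

upMatch : List Step → ℕ → ℕ → Bool
upMatch P i j = hk P j ≡ᵇ hk P (i ∸ 1)

downMatch : List Step → ℕ → ℕ → Bool
downMatch P i j = hk P (j ∸ 1) ≡ᵇ hk P i

-- The search in the definition of tunnel succeeds at i and finds j (a failed search
-- would silently return 0).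
data Matches (P : List Step) (i j : ℕ) : Set where
  up   : stepAt P i ≡ u → IsFirst (upMatch P i) (ascFrom i (length P)) j → Matches P i j
  down : stepAt P i ≡ d → IsFirst (downMatch P i) (descFrom i) j → Matches P i j

Matches⇒tunnel : ∀ {P i j} → Matches P i j → tunnel P i ≡ j
Matches⇒tunnel {P} {i} (up e hit) with stepAt P i | e
... | u | refl = firstSat-IsFirst hit
Matches⇒tunnel {P} {i} (down e hit) with stepAt P i | e
... | d | refl = firstSat-IsFirst hit

Matches-bounds : ∀ {P i j} → i ≤ length P → Matches P i j → 1 ≤ j × j ≤ length P
Matches-bounds {P} {i} i≤L (up _ hit) =
  IsFirst-all hit (All-map (λ (i<j , j≤L) → ≤-trans (s≤s z≤n) i<j , j≤L) (ascFrom-bounds i (length P)))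
Matches-bounds {P} {i} i≤L (down _ hit) =
  IsFirst-all hit (All-map (λ (1≤j , j<i) → 1≤j , ≤-trans (<⇒≤ j<i) i≤L) (descFrom-bounds i))

Matches-++ˡ : ∀ {X i j} Y → 1 ≤ i → i ≤ length X → Matches X i j → Matches (X ++ Y) i j
Matches-++ˡ {X} {i} Y 1≤i i≤L (up e hit) =
  up (trans (stepAt-++ˡ X Y i 1≤i i≤L) e)
     (subst (λ xs → IsFirst (upMatch (X ++ Y) i) xs _)
        (sym (ascFrom-split i (length X) (length (X ++ Y)) i≤L (length-++-≤ˡ X)))
        (IsFirst-++ʳ _ (IsFirst-cong same hit)))
  where
  same : All (λ j → upMatch (X ++ Y) i j ≡ upMatch X i j) (ascFrom i (length X))
  same = All-map (λ (_ , j≤L) → cong₂ _≡ᵇ_ (hk-++ˡ X Y _ j≤L) (hk-++ˡ X Y (i ∸ 1) (≤-trans (m∸n≤m i 1) i≤L)))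
                 (ascFrom-bounds i (length X))
Matches-++ˡ {X} {i} Y 1≤i i≤L (down e hit) =
  down (trans (stepAt-++ˡ X Y i 1≤i i≤L) e) (IsFirst-cong same hit)
  where
  same : All (λ j → downMatch (X ++ Y) i j ≡ downMatch X i j) (descFrom i)
  same = All-map (λ (_ , j<i) → cong₂ _≡ᵇ_ (hk-++ˡ X Y _ (≤-trans (m∸n≤m _ 1) (≤-trans (<⇒≤ j<i) i≤L)))
                                           (hk-++ˡ X Y i i≤L))
                 (descFrom-bounds i)

Matches-++ʳ : ∀ {Y t j} X → Balanced X → Matches Y (suc t) j → Matches (X ++ Y) (length X + suc t) (length X + j)
Matches-++ʳ {Y} {t} X bX (up e hit) =
  up (trans (stepAt-++ʳ X Y t) e)
     (subst (λ xs → IsFirst (upMatch (X ++ Y) (L + suc t)) xs _)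
        (sym (trans (cong (ascFrom (L + suc t)) (length-++ X)) (ascFrom-+ L (suc t) (length Y))))
        (IsFirst-map (L +_) (universal shifted _) hit))
  where
  L = length X
  shifted : ∀ j → upMatch (X ++ Y) (L + suc t) (L + j) ≡ upMatch Y (suc t) j
  shifted j = cong₂ _≡ᵇ_ (hk-++ʳ X Y j bX) (trans (cong (λ k → hk (X ++ Y) (k ∸ 1)) (+-suc L t)) (hk-++ʳ X Y t bX))
Matches-++ʳ {Y} {t} X bX (down e hit) =
  down (trans (stepAt-++ʳ X Y t) e)
       (subst (λ xs → IsFirst (downMatch (X ++ Y) (L + suc t)) xs _)
          (sym (descFrom-+ L t))
          (IsFirst-++ʳ _ (IsFirst-map (L +_) shifted hit)))
  where
  L = length X
  shifted : All (λ j → downMatch (X ++ Y) (L + suc t) (L + j) ≡ downMatch Y (suc t) j) (descFrom (suc t))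
  shifted = All-map (λ { {suc j} _ → cong₂ _≡ᵇ_ (trans (cong (λ k → hk (X ++ Y) (k ∸ 1)) (+-suc L j)) (hk-++ʳ X Y j bX))
                                                (hk-++ʳ X Y (suc t) bX) })
                    (descFrom-bounds (suc t))

Matches-lift-first : ∀ {X} → NonNegative X → Balanced X → Matches (lift X) 1 (suc (suc (length X)))
Matches-lift-first {X} nX bX =
  up refl (subst (λ xs → IsFirst (upMatch (lift X) 1) xs (suc (suc L)))
             (sym (trans (cong (ascFrom 1) (length-lift X)) (ascFrom-lift 0 L z≤n)))
             (IsFirst-++ˡ _ below (here (cong (_≡ᵇ 0) (hk-lift-end X bX)))))
  where
  L = length X
  below : All (λ j → upMatch (lift X) 1 j ≡ false) (map suc (ascFrom 0 L))
  below = All-map⁺ (All-map (λ (_ , j≤L) → cong (_≡ᵇ 0) (hk-lift X _ nX j≤L)) (ascFrom-bounds 0 L))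

Matches-lift-inner : ∀ {X i j} → NonNegative X → 1 ≤ i → i ≤ length X → Matches X i j → Matches (lift X) (suc i) (suc j)
Matches-lift-inner {X} {suc k} nX _ i≤L (up e hit) =
  up (trans (stepAt-++ˡ X (d ∷ []) (suc k) (s≤s z≤n) i≤L) e)
     (subst (λ xs → IsFirst (upMatch (lift X) (suc (suc k))) xs _)
        (sym (trans (cong (ascFrom (suc (suc k))) (length-lift X)) (ascFrom-lift (suc k) (length X) i≤L)))
        (IsFirst-++ʳ _ (IsFirst-map suc lifted hit)))
  where
  lifted : All (λ j → upMatch (lift X) (suc (suc k)) (suc j) ≡ upMatch X (suc k) j) (ascFrom (suc k) (length X))
  lifted = All-map (λ (_ , j≤L) → cong₂ _≡ᵇ_ (hk-lift X _ nX j≤L) (hk-lift X k nX (<⇒≤ i≤L)))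
                   (ascFrom-bounds (suc k) (length X))
Matches-lift-inner {X} {suc k} nX _ i≤L (down e hit) =
  down (trans (stepAt-++ˡ X (d ∷ []) (suc k) (s≤s z≤n) i≤L) e)
       (subst (λ xs → IsFirst (downMatch (lift X) (suc (suc k))) xs _)
          (sym (descFrom-+ 1 k))
          (IsFirst-++ʳ _ (IsFirst-map suc lifted hit)))
  where
  lifted : All (λ j → downMatch (lift X) (suc (suc k)) (suc j) ≡ downMatch X (suc k) j) (descFrom (suc k))
  lifted = All-map (λ { {suc j} (_ , j<i) → cong₂ _≡ᵇ_ (hk-lift X j nX (≤-trans (<⇒≤ (≤-pred j<i)) (<⇒≤ i≤L)))
                                                       (hk-lift X (suc k) nX i≤L) })
                   (descFrom-bounds (suc k))

Matches-lift-last : ∀ {X} → NonNegative X → Balanced X → Matches (lift X) (suc (suc (length X))) 1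
Matches-lift-last {X} nX bX =
  down (stepAt-lift-end X)
       (subst (λ xs → IsFirst (downMatch (lift X) (suc (suc L))) xs 1)
          (sym (descFrom-+ 1 L))
          (IsFirst-++ˡ _ above (here (cong (0 ≡ᵇ_) (hk-lift-end X bX)))))
  where
  L = length X
  above : All (λ j → downMatch (lift X) (suc (suc L)) j ≡ false) (map suc (descFrom (suc L)))
  above = All-map⁺ (All-map (λ { {suc j} (_ , j<i) → cong₂ _≡ᵇ_ (hk-lift X j nX (<⇒≤ (≤-pred j<i))) (hk-lift-end X bX) })
                            (descFrom-bounds (suc L)))

mutual
  matched : ∀ {P i} → DyckPath P → 1 ≤ i → i ≤ length P → ∃ (Matches P i)
  matched {i = suc _} [] _ ()
  matched {i = i} (join {X} {Y} dX dY) 1≤i i≤L with within (length (lift X)) i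
  ... | inside i≤M = map₂ (Matches-++ˡ Y 1≤i i≤M) (matched-lift dX 1≤i i≤M)
  ... | beyond t   = ×-map (length (lift X) +_) (Matches-++ʳ (lift X) (Balanced-lift {X} (DyckPath-balanced dX)))
                          (matched dY (s≤s z≤n) (length-++-cancelˡ (lift X) t i≤L))

  matched-lift : ∀ {X i} → DyckPath X → 1 ≤ i → i ≤ length (lift X) → ∃ (Matches (lift X) i)
  matched-lift {X} {suc j} dX _ i≤M with within (length X) j
  ... | inside j≤L     = matched-lift-inside dX j≤L
  ... | beyond zero    = _ , subst (λ i → Matches (lift X) (suc i) 1) (+-comm 1 (length X))
                                   (Matches-lift-last (DyckPath-nonNegative dX) (DyckPath-balanced dX))
  ... | beyond (suc t) = ⊥-elim (lift-overshoot X t i≤M)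

  matched-lift-inside : ∀ {X j} → DyckPath X → j ≤ length X → ∃ (Matches (lift X) (suc j))
  matched-lift-inside {j = zero}  dX _   = _ , Matches-lift-first (DyckPath-nonNegative dX) (DyckPath-balanced dX)
  matched-lift-inside {j = suc k} dX j≤L =
    ×-map suc (Matches-lift-inner (DyckPath-nonNegative dX) (s≤s z≤n) j≤L) (matched dX (s≤s z≤n) j≤L)

tunnel-via : ∀ {P Q i i′} (f : ℕ → ℕ) → (∀ {j} → Matches P i j → Matches Q i′ (f j)) →
  ∃ (Matches P i) → tunnel Q i′ ≡ f (tunnel P i)
tunnel-via f transport (j , m) = trans (Matches⇒tunnel (transport m)) (cong f (sym (Matches⇒tunnel m)))

module _ {X : List Step} (dX : DyckPath X) where

  tunnel-bounds : ∀ {i} → 1 ≤ i → i ≤ length X → 1 ≤ tunnel X i × tunnel X i ≤ length X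
  tunnel-bounds 1≤i i≤L with matched dX 1≤i i≤L
  ... | j , m rewrite Matches⇒tunnel m = Matches-bounds i≤L m

  tunnel-++ˡ : ∀ Y {i} → 1 ≤ i → i ≤ length X → tunnel (X ++ Y) i ≡ tunnel X i
  tunnel-++ˡ Y 1≤i i≤L = tunnel-via (λ j → j) (Matches-++ˡ Y 1≤i i≤L) (matched dX 1≤i i≤L)

  tunnel-++ʳ : ∀ {Y} → DyckPath Y → ∀ t → suc t ≤ length Y →
    tunnel (X ++ Y) (length X + suc t) ≡ length X + tunnel Y (suc t)
  tunnel-++ʳ dY t t<L = tunnel-via (length X +_) (Matches-++ʳ X (DyckPath-balanced dX)) (matched dY (s≤s z≤n) t<L)

  tunnel-lift-first : tunnel (lift X) 1 ≡ suc (suc (length X))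
  tunnel-lift-first = Matches⇒tunnel (Matches-lift-first (DyckPath-nonNegative dX) (DyckPath-balanced dX))

  tunnel-lift-inner : ∀ {i} → 1 ≤ i → i ≤ length X → tunnel (lift X) (suc i) ≡ suc (tunnel X i)
  tunnel-lift-inner 1≤i i≤L =
    tunnel-via suc (Matches-lift-inner (DyckPath-nonNegative dX) 1≤i i≤L) (matched dX 1≤i i≤L)

  tunnel-lift-last : tunnel (lift X) (suc (suc (length X))) ≡ 1
  tunnel-lift-last = Matches⇒tunnel (Matches-lift-last (DyckPath-nonNegative dX) (DyckPath-balanced dX))

-- Unpaired steps in prefix windows

count-escaping : (ℕ → ℕ) → ℕ → List ℕ → ℕ
count-escaping f k = count (λ i → not (f i ∈ᵇ range1 k))

count-escaping-≡0 : ∀ f m k → (∀ {i} → 1 ≤ i → i ≤ m → 1 ≤ f i × f i ≤ k) → count-escaping f k (range1 m) ≡ 0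
count-escaping-≡0 f m k inRange =
  count-none (range1 m) (All-map (λ (1≤i , i≤m) → let (1≤fi , fi≤k) = inRange 1≤i i≤m
                                                   in cong not (∈ᵇ-range1 1≤fi fi≤k))
                                 (range1-bounds m))

count-escaping-+ : ∀ (f g : ℕ → ℕ) c t → (∀ {s} → 1 ≤ s → s ≤ t → g (c + s) ≡ c + f s × 1 ≤ f s) →
  count-escaping g (c + t) (map (c +_) (range1 t)) ≡ count-escaping f t (range1 t)
count-escaping-+ f g c t shift = trans (count-map _ (c +_) (range1 t)) (count-cong (range1 t) (All-map same (range1-bounds t)))
  where
  same : ∀ {s} → 1 ≤ s × s ≤ t → not (g (c + s) ∈ᵇ range1 (c + t)) ≡ not (f s ∈ᵇ range1 t)
  same (1≤s , s≤t) with shift 1≤s s≤t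
  ... | g≡ , 1≤fs = cong not (trans (cong (_∈ᵇ range1 (c + t)) g≡) (+-∈ᵇ-range1 c t 1≤fs))

unpaired-whole : ∀ {P} → DyckPath P → unpairedIn P (range1 (length P)) ≡ 0
unpaired-whole dP = count-escaping-≡0 _ _ _ (tunnel-bounds dP)

UnpairedIsHeight : List Step → Set
UnpairedIsHeight P = ∀ k → k ≤ length P → unpairedIn P (range1 k) ≡ hk P k

UnpairedIsHeight-++ : ∀ {X Y} → DyckPath X → DyckPath Y → UnpairedIsHeight X → UnpairedIsHeight Y → UnpairedIsHeight (X ++ Y)
UnpairedIsHeight-++ {X} {Y} dX dY hX hY k k≤M with within (length X) k
... | inside k≤L = begin
    count-escaping (tunnel (X ++ Y)) k (range1 k)
  ≡⟨ count-cong (range1 k) (All-map (λ (1≤i , i≤k) → cong (λ j → not (j ∈ᵇ range1 k))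
                                                           (tunnel-++ˡ dX Y 1≤i (≤-trans i≤k k≤L)))
                                     (range1-bounds k)) ⟩
    unpairedIn X (range1 k)  ≡⟨ hX k k≤L ⟩
    hk X k                   ≡⟨ sym (hk-++ˡ X Y k k≤L) ⟩
    hk (X ++ Y) k            ∎
  where open ≡-Reasoning
... | beyond t = begin
    escaping (range1 (L + suc t))                                ≡⟨ cong escaping (range1-+ L (suc t)) ⟩
    escaping (range1 L ++ map (L +_) (range1 (suc t)))           ≡⟨ count-++ _ (range1 L) _ ⟩
    escaping (range1 L) + escaping (map (L +_) (range1 (suc t)))
      ≡⟨ cong₂ _+_ (count-escaping-≡0 _ L (L + suc t) pairedInX) (count-escaping-+ (tunnel Y) _ L (suc t) shiftedY) ⟩
    unpairedIn Y (range1 (suc t))                                ≡⟨ hY (suc t) t<L′ ⟩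
    hk Y (suc t)                                                 ≡⟨ sym (hk-++ʳ X Y (suc t) (DyckPath-balanced dX)) ⟩
    hk (X ++ Y) (L + suc t)                                      ∎
  where
  open ≡-Reasoning
  L = length X
  escaping : List ℕ → ℕ
  escaping = count-escaping (tunnel (X ++ Y)) (L + suc t)
  t<L′ : suc t ≤ length Y
  t<L′ = length-++-cancelˡ X t k≤M
  pairedInX : ∀ {i} → 1 ≤ i → i ≤ L → 1 ≤ tunnel (X ++ Y) i × tunnel (X ++ Y) i ≤ L + suc t
  pairedInX 1≤i i≤L rewrite tunnel-++ˡ dX Y 1≤i i≤L =
    let (1≤j , j≤L) = tunnel-bounds dX 1≤i i≤L in 1≤j , ≤-trans j≤L (m≤m+n L (suc t))
  shiftedY : ∀ {s} → 1 ≤ s → s ≤ suc t → tunnel (X ++ Y) (L + s) ≡ L + tunnel Y s × 1 ≤ tunnel Y s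
  shiftedY {suc s} _ s≤t =
    tunnel-++ʳ dX dY s (≤-trans s≤t t<L′) , proj₁ (tunnel-bounds dY (s≤s z≤n) (≤-trans s≤t t<L′))

UnpairedIsHeight-lift : ∀ {X} → DyckPath X → UnpairedIsHeight X → UnpairedIsHeight (lift X)
UnpairedIsHeight-lift dX hX zero _ = refl
UnpairedIsHeight-lift {X} dX hX (suc j) j<M with within (length X) j
... | inside j≤L = begin
    count-escaping (tunnel (lift X)) (suc j) (range1 (suc j))
  ≡⟨ cong (count-escaping (tunnel (lift X)) (suc j)) (range1-+ 1 j) ⟩
    count-escaping (tunnel (lift X)) (suc j) (1 ∷ map suc (range1 j))
  ≡⟨ count-here {p = λ i → not (tunnel (lift X) i ∈ᵇ range1 (suc j))} 1 (map suc (range1 j)) firstEscapes ⟩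
    suc (count-escaping (tunnel (lift X)) (suc j) (map suc (range1 j)))
  ≡⟨ cong suc (count-escaping-+ (tunnel X) _ 1 j shiftedX) ⟩
    suc (unpairedIn X (range1 j))
  ≡⟨ cong suc (hX j j≤L) ⟩
    suc (hk X j)
  ≡⟨ sym (hk-lift X j (DyckPath-nonNegative dX) j≤L) ⟩
    hk (lift X) (suc j) ∎
  where
  open ≡-Reasoning
  firstEscapes : not (tunnel (lift X) 1 ∈ᵇ range1 (suc j)) ≡ true
  firstEscapes = cong not (trans (cong (_∈ᵇ range1 (suc j)) (tunnel-lift-first dX)) (∉ᵇ-range1 (s≤s (s≤s j≤L))))
  shiftedX : ∀ {s} → 1 ≤ s → s ≤ j → tunnel (lift X) (suc s) ≡ suc (tunnel X s) × 1 ≤ tunnel X s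
  shiftedX 1≤s s≤j = tunnel-lift-inner dX 1≤s (≤-trans s≤j j≤L) , proj₁ (tunnel-bounds dX 1≤s (≤-trans s≤j j≤L))
... | beyond zero = subst (λ k → unpairedIn (lift X) (range1 k) ≡ hk (lift X) k) (cong suc (+-comm 1 (length X)))
  (trans (subst (λ k → unpairedIn (lift X) (range1 k) ≡ 0) (length-lift X) (unpaired-whole (DyckPath-lift dX)))
         (sym (hk-lift-end X (DyckPath-balanced dX))))
... | beyond (suc t) = ⊥-elim (lift-overshoot X t j<M)

unpairedIsHeight : ∀ {P} → DyckPath P → UnpairedIsHeight P
unpairedIsHeight []           zero z≤n = refl
unpairedIsHeight (join dX dY) =
  UnpairedIsHeight-++ (DyckPath-lift dX) dY (UnpairedIsHeight-lift dX (unpairedIsHeight dX)) (unpairedIsHeight dY)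

window-1 : ∀ m .{{_ : NonZero m}} k → k ≤ m → window m 1 k ≡ range1 k
window-1 m k k≤m = applyUpTo-cong k (λ t t<k → cong suc (m<n⇒m%n≡m (≤-trans t<k k≤m)))

umax-1 : ∀ n {P} → DyckPath P → length P ≡ suc n + suc n → umax (suc n) 1 P ≡ height P
umax-1 n {P} dP P≡ = trans
  (cong maxOver (map-cong-local (All-map prefixHeight (range1-bounds (suc n + suc n)))))
  (cong (λ m → maxOver (map (hk P) (range1 m))) (sym P≡))
  where
  prefixHeight : ∀ {k} → 1 ≤ k × k ≤ suc n + suc n → uak (suc n) P 1 k ≡ hk P k
  prefixHeight (_ , k≤m) =
    trans (cong (unpairedIn P) (window-1 _ _ k≤m)) (unpairedIsHeight dP _ (≤-trans k≤m (≤-reflexive (sym P≡))))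

-- Rotation

-- Cuts w = A d B at the first down step that ends h + 1 levels below the start of w.
splitAtReturn : ℕ → List Step → List Step × List Step
splitAtReturn h       []      = [] , []
splitAtReturn h       (u ∷ w) = map₁ (u ∷_) (splitAtReturn (suc h) w)
splitAtReturn zero    (d ∷ w) = [] , w
splitAtReturn (suc h) (d ∷ w) = map₁ (d ∷_) (splitAtReturn h w)

-- rotate (u A d B) = A u B d, where u A d is the first return to the axis.  This is not
-- a rotation of the word, but it rotates the tunnelling: see rotate-tunnel.
rotate : List Step → List Step
rotate (u ∷ w) = proj₁ (splitAtReturn 0 w) ++ lift (proj₂ (splitAtReturn 0 w))
rotate (d ∷ w) = []
rotate []      = []

splitAtReturn-DyckPath : ∀ {A} → DyckPath A → ∀ h w → splitAtReturn h (A ++ w) ≡ map₁ (A ++_) (splitAtReturn h w)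
splitAtReturn-DyckPath []                   h w = refl
splitAtReturn-DyckPath (join {X} {Y} dX dY) h w = begin
    splitAtReturn h ((lift X ++ Y) ++ w)
  ≡⟨ cong (splitAtReturn h) (trans (++-assoc (lift X) Y w) (lift-++ X (Y ++ w))) ⟩
    map₁ (u ∷_) (splitAtReturn (suc h) (X ++ d ∷ Y ++ w))
  ≡⟨ cong (map₁ (u ∷_)) (splitAtReturn-DyckPath dX (suc h) (d ∷ Y ++ w)) ⟩
    map₁ (λ Z → u ∷ X ++ d ∷ Z) (splitAtReturn h (Y ++ w))
  ≡⟨ cong (map₁ (λ Z → u ∷ X ++ d ∷ Z)) (splitAtReturn-DyckPath dY h w) ⟩
    map₁ (λ Z → u ∷ X ++ d ∷ Y ++ Z) (splitAtReturn h w)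
  ≡⟨ cong (_, proj₂ (splitAtReturn h w)) (sym (trans (++-assoc (lift X) Y _) (lift-++ X (Y ++ _)))) ⟩
    map₁ ((lift X ++ Y) ++_) (splitAtReturn h w) ∎
  where open ≡-Reasoning

rotate-join : ∀ {A} B → DyckPath A → rotate (lift A ++ B) ≡ A ++ lift B
rotate-join {A} B dA rewrite ++-assoc A (d ∷ []) B | splitAtReturn-DyckPath dA 0 (d ∷ B) | ++-identityʳ A = refl

flipStep : Step → Step
flipStep u = d
flipStep d = u

mirror : List Step → List Step
mirror X = reverse (map flipStep X)

mirror-++ : ∀ X Y → mirror (X ++ Y) ≡ mirror Y ++ mirror X
mirror-++ X Y = trans (cong reverse (map-++ flipStep X Y)) (reverse-++ (map flipStep X) (map flipStep Y))

mirror-lift : ∀ X → mirror (lift X) ≡ lift (mirror X)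
mirror-lift X = begin
    reverse (d ∷ map flipStep (X ++ d ∷ []))      ≡⟨ cong (λ Z → reverse (d ∷ Z)) (map-++ flipStep X (d ∷ [])) ⟩
    reverse (d ∷ (map flipStep X ++ u ∷ []))      ≡⟨ unfold-reverse d (map flipStep X ++ u ∷ []) ⟩
    reverse (map flipStep X ++ u ∷ []) ++ d ∷ []  ≡⟨ cong (_++ d ∷ []) (reverse-++ (map flipStep X) (u ∷ [])) ⟩
    lift (mirror X)                               ∎
  where open ≡-Reasoning

mirror-involutive : ∀ X → mirror (mirror X) ≡ X
mirror-involutive X = begin
    reverse (map flipStep (reverse (map flipStep X)))  ≡⟨ cong reverse (reverse-map flipStep (map flipStep X)) ⟩
    reverse (reverse (map flipStep (map flipStep X)))  ≡⟨ reverse-involutive _ ⟩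
    map flipStep (map flipStep X)                      ≡⟨ sym (map-∘ X) ⟩
    map (λ s → flipStep (flipStep s)) X                ≡⟨ map-cong flipStep-involutive X ⟩
    map (λ s → s) X                                    ≡⟨ map-id X ⟩
    X                                                  ∎
  where
  open ≡-Reasoning
  flipStep-involutive : ∀ s → flipStep (flipStep s) ≡ s
  flipStep-involutive u = refl
  flipStep-involutive d = refl

length-mirror : ∀ X → length (mirror X) ≡ length X
length-mirror X = trans (length-reverse (map flipStep X)) (length-map flipStep X)

DyckPath-mirror : ∀ {X} → DyckPath X → DyckPath (mirror X)
DyckPath-mirror []                   = []
DyckPath-mirror (join {X} {Y} dX dY) =
  subst DyckPath (sym (trans (mirror-++ (lift X) Y) (cong (mirror Y ++_) (mirror-lift X))))
        (DyckPath-++ (DyckPath-mirror dY) (DyckPath-lift (DyckPath-mirror dX)))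

DyckPath-rotate : ∀ {P} → DyckPath P → DyckPath (rotate P)
DyckPath-rotate []                   = []
DyckPath-rotate (join {X} {Y} dX dY) = subst DyckPath (sym (rotate-join Y dX)) (DyckPath-++ dX (DyckPath-lift dY))

length-swap-lift : ∀ X Y → length (X ++ lift Y) ≡ length (lift X ++ Y)
length-swap-lift X Y = begin
    length (X ++ lift Y)             ≡⟨ length-++ X ⟩
    length X + length (lift Y)       ≡⟨ cong (length X +_) (length-lift Y) ⟩
    length X + suc (suc (length Y))  ≡⟨ +-suc (length X) (suc (length Y)) ⟩
    suc (length X + suc (length Y))  ≡⟨ cong suc (+-suc (length X) (length Y)) ⟩
    suc (suc (length X)) + length Y  ≡⟨ cong (_+ length Y) (sym (length-lift X)) ⟩
    length (lift X) + length Y       ≡⟨ sym (length-++ (lift X)) ⟩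
    length (lift X ++ Y)             ∎
  where open ≡-Reasoning

length-rotate : ∀ {P} → DyckPath P → length (rotate P) ≡ length P
length-rotate []                   = refl
length-rotate (join {X} {Y} dX dY) = trans (cong length (rotate-join Y dX)) (length-swap-lift X Y)

rotate-mirror-rotate : ∀ {P} → DyckPath P → rotate (mirror (rotate P)) ≡ mirror P
rotate-mirror-rotate []                   = refl
rotate-mirror-rotate (join {X} {Y} dX dY) = begin
    rotate (mirror (rotate (lift X ++ Y)))  ≡⟨ cong (λ Z → rotate (mirror Z)) (rotate-join Y dX) ⟩
    rotate (mirror (X ++ lift Y))           ≡⟨ cong rotate (trans (mirror-++ X (lift Y)) (cong (_++ mirror X) (mirror-lift Y))) ⟩
    rotate (lift (mirror Y) ++ mirror X)    ≡⟨ rotate-join (mirror X) (DyckPath-mirror dY) ⟩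
    mirror Y ++ lift (mirror X)             ≡⟨ cong (mirror Y ++_) (sym (mirror-lift X)) ⟩
    mirror Y ++ mirror (lift X)             ≡⟨ sym (mirror-++ (lift X) Y) ⟩
    mirror (lift X ++ Y)                    ∎
  where open ≡-Reasoning

unrotate : List Step → List Step
unrotate P = mirror (rotate (mirror P))

unrotate-rotate : ∀ {P} → DyckPath P → unrotate (rotate P) ≡ P
unrotate-rotate {P} dP = trans (cong mirror (rotate-mirror-rotate dP)) (mirror-involutive P)

rotate-unrotate : ∀ {P} → DyckPath P → rotate (unrotate P) ≡ P
rotate-unrotate {P} dP = trans (rotate-mirror-rotate (DyckPath-mirror dP)) (mirror-involutive P)

DyckPath-unrotate : ∀ {P} → DyckPath P → DyckPath (unrotate P)
DyckPath-unrotate dP = DyckPath-mirror (DyckPath-rotate (DyckPath-mirror dP))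

length-unrotate : ∀ {P} → DyckPath P → length (unrotate P) ≡ length P
length-unrotate {P} dP =
  trans (length-mirror (rotate (mirror P))) (trans (length-rotate (DyckPath-mirror dP)) (length-mirror P))

cyclePred : ℕ → ℕ → ℕ
cyclePred m zero          = zero
cyclePred m (suc zero)    = m
cyclePred m (suc (suc i)) = suc i

module _ {A B : List Step} (dA : DyckPath A) (dB : DyckPath B) where

  private
    a = length A
    b = length B
    m = length (lift A ++ B)
    σ = cyclePred m

    m≡ : m ≡ a + suc (suc b)
    m≡ = trans (sym (length-swap-lift A B)) (trans (length-++ A) (cong (a +_) (length-lift B)))

    tunnel-lift-A : ∀ {i} → 1 ≤ i → i ≤ suc (suc a) → tunnel (lift A ++ B) i ≡ tunnel (lift A) i
    tunnel-lift-A 1≤i i≤ = tunnel-++ˡ (DyckPath-lift dA) B 1≤i (≤-trans i≤ (≤-reflexive (sym (length-lift A))))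

  rotate-tunnel-first : tunnel (A ++ lift B) (σ 1) ≡ σ (tunnel (lift A ++ B) 1)
  rotate-tunnel-first = begin
    tunnel (A ++ lift B) m                      ≡⟨ cong (tunnel (A ++ lift B)) m≡ ⟩
    tunnel (A ++ lift B) (a + suc (suc b))      ≡⟨ tunnel-++ʳ dA (DyckPath-lift dB) (suc b) (≤-reflexive (sym (length-lift B))) ⟩
    a + tunnel (lift B) (suc (suc b))           ≡⟨ cong (a +_) (tunnel-lift-last dB) ⟩
    a + 1                                       ≡⟨ +-comm a 1 ⟩
    σ (suc (suc a))                             ≡⟨ cong σ (sym (tunnel-lift-first dA)) ⟩
    σ (tunnel (lift A) 1)                       ≡⟨ cong σ (sym (tunnel-lift-A (s≤s z≤n) (s≤s z≤n))) ⟩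
    σ (tunnel (lift A ++ B) 1)                  ∎
    where open ≡-Reasoning

  rotate-tunnel-inside : ∀ {i} → 1 ≤ i → i ≤ a → tunnel (A ++ lift B) (σ (suc i)) ≡ σ (tunnel (lift A ++ B) (suc i))
  rotate-tunnel-inside {suc k} 1≤i i≤a = begin
    tunnel (A ++ lift B) (suc k)                ≡⟨ tunnel-++ˡ dA (lift B) 1≤i i≤a ⟩
    tunnel A (suc k)                            ≡⟨ σ-suc (proj₁ (tunnel-bounds dA 1≤i i≤a)) ⟩
    σ (suc (tunnel A (suc k)))                  ≡⟨ cong σ (sym (tunnel-lift-inner dA 1≤i i≤a)) ⟩
    σ (tunnel (lift A) (suc (suc k)))           ≡⟨ cong σ (sym (tunnel-lift-A (s≤s z≤n) (s≤s (m≤n⇒m≤1+n i≤a)))) ⟩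
    σ (tunnel (lift A ++ B) (suc (suc k)))      ∎
    where
    open ≡-Reasoning
    σ-suc : ∀ {x} → 1 ≤ x → x ≡ σ (suc x)
    σ-suc {suc x} _ = refl

  rotate-tunnel-return : tunnel (A ++ lift B) (σ (suc (suc a))) ≡ σ (tunnel (lift A ++ B) (suc (suc a)))
  rotate-tunnel-return = begin
    tunnel (A ++ lift B) (suc a)                ≡⟨ cong (tunnel (A ++ lift B)) (+-comm 1 a) ⟩
    tunnel (A ++ lift B) (a + 1)                ≡⟨ tunnel-++ʳ dA (DyckPath-lift dB) 0 (s≤s z≤n) ⟩
    a + tunnel (lift B) 1                       ≡⟨ cong (a +_) (tunnel-lift-first dB) ⟩
    a + suc (suc b)                             ≡⟨ sym m≡ ⟩
    σ 1                                         ≡⟨ cong σ (sym (tunnel-lift-last dA)) ⟩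
    σ (tunnel (lift A) (suc (suc a)))           ≡⟨ cong σ (sym (tunnel-lift-A (s≤s z≤n) ≤-refl)) ⟩
    σ (tunnel (lift A ++ B) (suc (suc a)))      ∎
    where open ≡-Reasoning

  rotate-tunnel-beyond : ∀ t → suc t ≤ b →
    tunnel (A ++ lift B) (σ (suc (suc (a + suc t)))) ≡ σ (tunnel (lift A ++ B) (suc (suc (a + suc t))))
  rotate-tunnel-beyond t t<b = begin
    tunnel (A ++ lift B) (suc (a + suc t))      ≡⟨ cong (tunnel (A ++ lift B)) (sym (+-suc a (suc t))) ⟩
    tunnel (A ++ lift B) (a + suc (suc t))      ≡⟨ tunnel-++ʳ dA (DyckPath-lift dB) (suc t) t+1<lift-B ⟩
    a + tunnel (lift B) (suc (suc t))           ≡⟨ cong (a +_) (tunnel-lift-inner dB (s≤s z≤n) t<b) ⟩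
    a + suc (tunnel B (suc t))                  ≡⟨ +-suc a _ ⟩
    σ (suc (suc (a + tunnel B (suc t))))        ≡⟨ cong σ (sym tunnel-B) ⟩
    σ (tunnel (lift A ++ B) (suc (suc (a + suc t)))) ∎
    where
    open ≡-Reasoning
    t+1<lift-B : suc (suc t) ≤ length (lift B)
    t+1<lift-B = ≤-trans (s≤s (m≤n⇒m≤1+n t<b)) (≤-reflexive (sym (length-lift B)))
    tunnel-B : tunnel (lift A ++ B) (suc (suc (a + suc t))) ≡ suc (suc (a + tunnel B (suc t)))
    tunnel-B = begin
      tunnel (lift A ++ B) (suc (suc a) + suc t)        ≡⟨ cong (λ x → tunnel (lift A ++ B) (x + suc t)) (sym (length-lift A)) ⟩
      tunnel (lift A ++ B) (length (lift A) + suc t)    ≡⟨ tunnel-++ʳ (DyckPath-lift dA) dB t t<b ⟩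
      length (lift A) + tunnel B (suc t)                ≡⟨ cong (_+ tunnel B (suc t)) (length-lift A) ⟩
      suc (suc (a + tunnel B (suc t)))                  ∎

  rotate-tunnel : ∀ {i} → 1 ≤ i → i ≤ m → tunnel (A ++ lift B) (σ i) ≡ σ (tunnel (lift A ++ B) i)
  rotate-tunnel {suc j} _ i≤m with within a j
  ... | inside j≤a = within-lift-A j≤a
    where
    within-lift-A : ∀ {j} → j ≤ a → tunnel (A ++ lift B) (σ (suc j)) ≡ σ (tunnel (lift A ++ B) (suc j))
    within-lift-A {zero}  _   = rotate-tunnel-first
    within-lift-A {suc k} j≤a = rotate-tunnel-inside (s≤s z≤n) j≤a
  ... | beyond zero    = subst (λ i → tunnel (A ++ lift B) (σ i) ≡ σ (tunnel (lift A ++ B) i))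
                               (cong suc (+-comm 1 a)) rotate-tunnel-return
  ... | beyond (suc t) = subst (λ i → tunnel (A ++ lift B) (σ i) ≡ σ (tunnel (lift A ++ B) i))
                               (cong suc (sym (+-suc a (suc t)))) (rotate-tunnel-beyond t t<b)
    where
    t<b : suc t ≤ b
    t<b = ≤-pred (≤-pred (+-cancelˡ-≤ a _ _
            (subst (_≤ a + suc (suc b)) (sym (+-suc a (suc (suc t)))) (≤-trans i≤m (≤-reflexive m≡)))))

cyclePred-≡ᵇ : ∀ {m x y} → 1 ≤ x → x ≤ m → 1 ≤ y → y ≤ m → (cyclePred m y ≡ᵇ cyclePred m x) ≡ (y ≡ᵇ x)
cyclePred-≡ᵇ {m} {suc zero}    {suc zero}    _ _   _ _   = ≡ᵇ-refl m
cyclePred-≡ᵇ {m} {suc zero}    {suc (suc y)} _ _   _ y≤m = ≢⇒≡ᵇ-false (<⇒≢ y≤m)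
cyclePred-≡ᵇ {m} {suc (suc x)} {suc zero}    _ x≤m _ _   = ≢⇒≡ᵇ-false (≢-sym (<⇒≢ x≤m))
cyclePred-≡ᵇ {m} {suc (suc x)} {suc (suc y)} _ _   _ _   = refl

cyclePred-suc-% : ∀ m .{{_ : NonZero m}} x → cyclePred m (suc (suc x % m)) ≡ suc (x % m)
cyclePred-suc-% (suc m) x with suc x % suc m in eq
... | zero  = cong suc (sym (%-pred-≡0 {x} {suc m} eq))
... | suc r = cong suc (≤-antisym
                (m<[1+n%d]⇒m≤[n%d] {r} x (suc m) (subst (r <_) (sym eq) ≤-refl))
                ([1+m%d]≤1+n⇒[m%d]≤n x r (suc m) (subst (0 <_) (sym eq) (s≤s z≤n)) (≤-reflexive eq)))

cyclePred-window : ∀ m .{{_ : NonZero m}} a k → map (cyclePred m) (window m (suc (suc a)) k) ≡ window m (suc a) k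
cyclePred-window m a k = trans (map-applyUpTo _ (cyclePred m) k) (applyUpTo-cong k (λ t _ → cyclePred-suc-% m (a + t)))

window-bounds : ∀ m .{{_ : NonZero m}} a k → All (λ j → 1 ≤ j × j ≤ m) (window m a k)
window-bounds m a k = applyUpTo⁺₁ _ k (λ {t} _ → s≤s z≤n , m%n<n ((a ∸ 1) + t) m)

unpairedIn-map : ∀ (f : ℕ → ℕ) P Q m W → All (λ i → 1 ≤ i × i ≤ m) W →
  (∀ {x y} → 1 ≤ x → x ≤ m → 1 ≤ y → y ≤ m → (f y ≡ᵇ f x) ≡ (y ≡ᵇ x)) →
  (∀ {i} → 1 ≤ i → i ≤ m → tunnel Q (f i) ≡ f (tunnel P i)) →
  (∀ {i} → 1 ≤ i → i ≤ m → 1 ≤ tunnel P i × tunnel P i ≤ m) →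
  unpairedIn Q (map f W) ≡ unpairedIn P W
unpairedIn-map f P Q m W W-bounds f-injective conjugate bounds =
  trans (count-map _ f W) (count-cong W (All-map same W-bounds))
  where
  same : ∀ {i} → 1 ≤ i × i ≤ m → not (tunnel Q (f i) ∈ᵇ map f W) ≡ not (tunnel P i ∈ᵇ W)
  same {i} (1≤i , i≤m) with bounds 1≤i i≤m
  ... | 1≤j , j≤m = cong not (trans (cong (_∈ᵇ map f W) (conjugate 1≤i i≤m))
                      (∈ᵇ-map f (tunnel P i) W (All-map (λ (1≤y , y≤m) → f-injective 1≤j j≤m 1≤y y≤m) W-bounds)))

unpairedIn-rotate : ∀ {A B} → DyckPath A → DyckPath B → ∀ m .{{_ : NonZero m}} → length (lift A ++ B) ≡ m → ∀ a k →
  unpairedIn (rotate (lift A ++ B)) (window m (suc a) k) ≡ unpairedIn (lift A ++ B) (window m (suc (suc a)) k)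
unpairedIn-rotate {A} {B} dA dB m refl a k = begin
    unpairedIn (rotate (lift A ++ B)) (window m (suc a) k)
  ≡⟨ cong (λ Q → unpairedIn Q (window m (suc a) k)) (rotate-join B dA) ⟩
    unpairedIn (A ++ lift B) (window m (suc a) k)
  ≡⟨ cong (unpairedIn (A ++ lift B)) (sym (cyclePred-window m a k)) ⟩
    unpairedIn (A ++ lift B) (map (cyclePred m) (window m (suc (suc a)) k))
  ≡⟨ unpairedIn-map (cyclePred m) (lift A ++ B) (A ++ lift B) m _ (window-bounds m (suc (suc a)) k)
       cyclePred-≡ᵇ (rotate-tunnel dA dB) (tunnel-bounds (join dA dB)) ⟩
    unpairedIn (lift A ++ B) (window m (suc (suc a)) k)
  ∎
  where open ≡-Reasoning

umax-rotate : ∀ n a {P} → DyckPath P → length P ≡ suc n + suc n →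
  umax (suc n) (suc (suc a)) P ≡ umax (suc n) (suc a) (rotate P)
umax-rotate n a (join dA dB) P≡ =
  cong maxOver (map-cong (λ k → sym (unpairedIn-rotate dA dB (suc n + suc n) P≡ a k)) (range1 (suc n + suc n)))

-- Enumeration of 𝒟_n

extensions : List Step → List (List Step)
extensions w = (u ∷ w) ∷ (d ∷ w) ∷ []

words-length : ∀ m {P} → P ∈ words m → length P ≡ m
words-length zero    (here refl) = refl
words-length (suc m) P∈ with find (∈-concatMap⁻ extensions {xs = words m} P∈)
... | w , w∈ , here refl         = cong suc (words-length m w∈)
... | w , w∈ , there (here refl) = cong suc (words-length m w∈)

∈-words : ∀ P → P ∈ words (length P)
∈-words []      = here refl
∈-words (s ∷ P) = ∈-concatMap⁺ extensions (Any-map (λ { refl → extension s }) (∈-words P))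
  where
  extension : ∀ s → (s ∷ P) ∈ extensions P
  extension u = here refl
  extension d = there (here refl)

words-unique : ∀ m → Unique (words m)
words-unique zero    = [] ∷ []
words-unique (suc m) =
  Unique.concat⁺ (All-map⁺ (universal (λ _ → ((λ ()) ∷ []) ∷ [] ∷ []) (words m)))
                 (AllPairs.map⁺ (AllPairs-map disjoint (words-unique m)))
  where
  disjoint : ∀ {w w′} → w ≢ w′ → Disjoint (extensions w) (extensions w′)
  disjoint w≢w′ (here refl         , here refl)         = w≢w′ refl
  disjoint w≢w′ (there (here refl) , there (here refl)) = w≢w′ refl
  disjoint w≢w′ (here refl         , there (here ()))
  disjoint w≢w′ (there (here refl) , here ())

data Walk : ℕ → List Step → Set where
  []   : Walk 0 []
  up   : ∀ {h w} → Walk (suc h) w → Walk h (u ∷ w)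
  down : ∀ {h w} → Walk h w → Walk (suc h) (d ∷ w)

data Returns : ℕ → List Step → Set where
  dyck : ∀ {w} → DyckPath w → Returns 0 w
  _d∷_ : ∀ {h X Y} → DyckPath X → Returns h Y → Returns (suc h) (X ++ d ∷ Y)

Walk⇒Returns : ∀ {h w} → Walk h w → Returns h w
Walk⇒Returns []          = dyck []
Walk⇒Returns (down walk) = [] d∷ Walk⇒Returns walk
Walk⇒Returns (up walk) with Walk⇒Returns walk
... | _d∷_ {X = X} {Y} dX (dyck dY) = dyck (subst DyckPath (lift-++ X Y) (join dX dY))
... | _d∷_ {X = X} dX (_d∷_ {X = X′} {Y′} dX′ rest) =
  subst (Returns _) (trans (++-assoc (lift X) X′ (d ∷ Y′)) (lift-++ X (X′ ++ d ∷ Y′))) (join dX dX′ d∷ rest)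

walk : ∀ h w → (∀ k → #d (take k w) ≤ h + #u (take k w)) → h + #u w ≡ #d w → Walk h w
walk zero    []      _      _   = []
walk (suc h) []      _      end = ⊥-elim (1+n≢0 (trans (cong suc (sym (+-identityʳ h))) end))
walk h       (u ∷ w) above  end =
  up (walk (suc h) w (λ k → subst (#d (take k w) ≤_) (+-suc h _) (above (suc k))) (trans (sym (+-suc h (#u w))) end))
walk zero    (d ∷ w) above  _   = ⊥-elim (<⇒≱ (s≤s z≤n) (above 1))
walk (suc h) (d ∷ w) above  end = down (walk h w (λ k → ≤-pred (above (suc k))) (suc-injective end))

length≡#u+#d : ∀ P → length P ≡ #u P + #d P
length≡#u+#d []      = refl
length≡#u+#d (u ∷ P) = cong suc (length≡#u+#d P)
length≡#u+#d (d ∷ P) = trans (cong suc (length≡#u+#d P)) (sym (+-suc (#u P) (#d P)))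

+-self-injective : ∀ {a b} → a + a ≡ b + b → a ≡ b
+-self-injective {a} {b} a+a≡b+b with <-cmp a b
... | tri< a<b _ _ = ⊥-elim (<⇒≢ (+-mono-< a<b a<b) a+a≡b+b)
... | tri≈ _ a≡b _ = a≡b
... | tri> _ _ b<a = ⊥-elim (<⇒≢ (+-mono-< b<a b<a) (sym a+a≡b+b))

nonNegativeAtᵇ : List Step → ℕ → Bool
nonNegativeAtᵇ P k = #d (take k P) ≤ᵇ #u (take k P)

isDyck⇒DyckPath : ∀ N P → T (isDyck N P) → DyckPath P
isDyck⇒DyckPath N P ok with Equivalence.to T-∧ ok
... | #u≡ , rest with Equivalence.to T-∧ rest
... | #d≡ , prefixes = Returns⇒DyckPath (Walk⇒Returns (walk 0 P nonNegative
                          (trans (≡ᵇ⇒≡ _ _ #u≡) (sym (≡ᵇ⇒≡ _ _ #d≡)))))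
  where
  Returns⇒DyckPath : ∀ {w} → Returns 0 w → DyckPath w
  Returns⇒DyckPath (dyck dw) = dw
  prefix : ∀ {k} → k ≤ length P → #d (take k P) ≤ #u (take k P)
  prefix k≤L = ≤ᵇ⇒≤ _ _ (applyUpTo⁻ (λ k → k) (suc (length P)) (all⁺ (nonNegativeAtᵇ P) _ prefixes) (s≤s k≤L))
  nonNegative : NonNegative P
  nonNegative k with k ≤? length P
  ... | yes k≤L = prefix k≤L
  ... | no  k≰L rewrite take-all k P (<⇒≤ (≰⇒> k≰L)) =
    subst (λ Q → #d Q ≤ #u Q) (take-all (length P) P ≤-refl) (prefix ≤-refl)

DyckPath⇒isDyck : ∀ N {P} → DyckPath P → length P ≡ N + N → T (isDyck N P)
DyckPath⇒isDyck N {P} dP P≡ =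
  Equivalence.from T-∧ (≡⇒≡ᵇ _ _ (trans (DyckPath-balanced dP) #d≡N) ,
    Equivalence.from T-∧ (≡⇒≡ᵇ _ _ #d≡N ,
      all⁻ (nonNegativeAtᵇ P) (applyUpTo⁺₁ (λ k → k) (suc (length P)) (λ {k} _ → ≤⇒≤ᵇ (DyckPath-nonNegative dP k)))))
  where
  #d≡N : #d P ≡ N
  #d≡N = +-self-injective (trans (cong (_+ #d P) (sym (DyckPath-balanced dP))) (trans (sym (length≡#u+#d P)) P≡))

∈-Dyck⁻ : ∀ N {P} → P ∈ Dyck N → DyckPath P × length P ≡ N + N
∈-Dyck⁻ N {P} P∈ with ∈-filter⁻ (λ P → T? (isDyck N P)) {xs = words (N + N)} P∈
... | P∈words , ok = isDyck⇒DyckPath N P ok , words-length (N + N) P∈words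

∈-Dyck⁺ : ∀ N {P} → DyckPath P → length P ≡ N + N → P ∈ Dyck N
∈-Dyck⁺ N {P} dP P≡ =
  ∈-filter⁺ (λ P → T? (isDyck N P)) (subst (λ m → P ∈ words m) P≡ (∈-words P)) (DyckPath⇒isDyck N dP P≡)

Dyck-unique : ∀ N → Unique (Dyck N)
Dyck-unique N = Unique.filter⁺ (λ P → T? (isDyck N P)) (words-unique (N + N))

countDyck-cong : ∀ N {f g : List Step → ℕ} ℓ → (∀ {P} → DyckPath P → length P ≡ N + N → f P ≡ g P) →
  countDyck N f ℓ ≡ countDyck N g ℓ
countDyck-cong N ℓ f≡g =
  count-cong (Dyck N) (tabulate (λ P∈ → let (dP , P≡) = ∈-Dyck⁻ N P∈ in cong (_≡ᵇ ℓ) (f≡g dP P≡)))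

countDyck-rotate : ∀ N (f : List Step → ℕ) ℓ → countDyck N (λ P → f (rotate P)) ℓ ≡ countDyck N f ℓ
countDyck-rotate N f ℓ = count-bijection (λ P → f P ≡ᵇ ℓ) rotate unrotate (Dyck-unique N)
  (λ P∈ → let (dP , P≡) = ∈-Dyck⁻ N P∈ in ∈-Dyck⁺ N (DyckPath-rotate dP) (trans (length-rotate dP) P≡))
  (λ P∈ → let (dP , P≡) = ∈-Dyck⁻ N P∈ in ∈-Dyck⁺ N (DyckPath-unrotate dP) (trans (length-unrotate dP) P≡))
  (λ P∈ → unrotate-rotate (proj₁ (∈-Dyck⁻ N P∈)))
  (λ P∈ → rotate-unrotate (proj₁ (∈-Dyck⁻ N P∈)))

countDyck-umax : ∀ n a ℓ → countDyck (suc n) (umax (suc n) (suc a)) ℓ ≡ countDyck (suc n) height ℓ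
countDyck-umax n zero    ℓ = countDyck-cong (suc n) ℓ (umax-1 n)
countDyck-umax n (suc a) ℓ = begin
  countDyck (suc n) (umax (suc n) (suc (suc a))) ℓ          ≡⟨ countDyck-cong (suc n) ℓ (umax-rotate n a) ⟩
  countDyck (suc n) (λ P → umax (suc n) (suc a) (rotate P)) ℓ ≡⟨ countDyck-rotate (suc n) (umax (suc n) (suc a)) ℓ ⟩
  countDyck (suc n) (umax (suc n) (suc a)) ℓ                ≡⟨ countDyck-umax n a ℓ ⟩
  countDyck (suc n) height ℓ                                ∎
  where open ≡-Reasoning

corollary3 : (n : ℕ) → (a : ℕ) → 1 ≤ a → a ≤ suc n + suc n →
    (ℓ : ℕ) → 1 ≤ ℓ → ℓ ≤ suc n →
    countDyck (suc n) (umax (suc n) a) ℓ ≡ countDyck (suc n) height ℓ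
corollary3 n (suc a) _ _ ℓ _ _ = countDyck-umax n a ℓ
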